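{- Let $r\ge2$ be an integer. If $\Gamma(2,2,r)$ has property R, then $r=2$.
   Context: For nonnegative integers $p\le q\le r$, $\Gamma(p,q,r)$ is the tree with $p+q+r+1$ vertices consisting of a vertex $c$ joined to an endpoint of each of three disjoint paths with $p$, $q$ and $r$ vertices. For a set $P$ with a symmetric reflexive relation $\mathcal{C}$: a labelled heap is $(E,\le,\varepsilon)$ with $(E,\le)$ a finite poset, $\varepsilon:E\to P$, such that elements with $\varepsilon(a)\,\mathcal{C}\,\varepsilon(b)$ are comparable and $\le$ is the transitive closure of "$a\le b$ and $\varepsilon(a)\,\mathcal{C}\,\varepsilon(b)$"; heaps are label-preserving isomorphism classes, forming $H(P,\mathcal{C})$. $E(v)$ is the subheap on $E\setminus\{v\}$. Trivial heap: trivial order. Convex chain: chain $x_1<\dots<x_t$ containing every $y$ with $x_i<y<x_j$; length $t$; balanced if $\varepsilon(x_1)=\varepsilon(x_t)$. Property P2: no balanced convex chain of length 2 or 3. $E(a)\prec^+E$ if $a$ is maximal in $E$ and some element maximal in $E(a)$ but not in $E$ has label $\ne\varepsilon(a)$; $\prec^-$ likewise with minimal elements; $\prec$ means either. Property P1: there is a (possibly trivial) sequence $E_1\prec\cdots\prec E$ with $E_1$ trivial. The concurrency graph of $H(P,\mathcal{C})$ has vertices $P$ and edges between distinct $v,w$ with $v\,\mathcal{C}\,w$. A graph has property R if it is the concurrency graph of a class of heaps in which every heap with property P2 has property P1. -}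

module Defs where

open import Data.Nat using (ℕ; zero; suc)
open import Data.Fin using (Fin; toℕ; fromℕ; inject₁) renaming (zero to fzero; suc to fsuc)
open import Data.Fin.Subset using (Subset; _∈_; _∉_; ⊤; _-_)
open import Data.Product using (Σ; ∃; _×_; _,_)
open import Data.Sum using (_⊎_)
open import Relation.Nullary using (¬_)
open import Relation.Binary.PropositionalEquality using (_≡_; _≢_; setoid)
open import Relation.Binary.Construct.Closure.Transitive using (TransClosure)
open import Function.Bundles using (_⇔_; _⤖_; Bijection)

record Graph : Set₁ where
  field
    V   : Set
    Adj : V → V → Set

-- The tree Γ(p,q,r): a centre c joined to an endpoint of three disjoint
-- paths with p, q, r vertices.  Position i (as a natural number toℕ i)
-- on an arm; position 0 is adjacent to the centre.

data ΓV (p q r : ℕ) : Set where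
  centre : ΓV p q r
  armP   : Fin p → ΓV p q r
  armQ   : Fin q → ΓV p q r
  armR   : Fin r → ΓV p q r

data ΓEdge (p q r : ℕ) : ΓV p q r → ΓV p q r → Set where
  cP : (i : Fin p) → toℕ i ≡ 0 → ΓEdge p q r centre (armP i)
  cQ : (i : Fin q) → toℕ i ≡ 0 → ΓEdge p q r centre (armQ i)
  cR : (i : Fin r) → toℕ i ≡ 0 → ΓEdge p q r centre (armR i)
  pP : (i j : Fin p) → suc (toℕ i) ≡ toℕ j → ΓEdge p q r (armP i) (armP j)
  pQ : (i j : Fin q) → suc (toℕ i) ≡ toℕ j → ΓEdge p q r (armQ i) (armQ j)
  pR : (i j : Fin r) → suc (toℕ i) ≡ toℕ j → ΓEdge p q r (armR i) (armR j)

Γ : ℕ → ℕ → ℕ → Graph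
Γ p q r = record
  { V   = ΓV p q r
  ; Adj = λ v w → ΓEdge p q r v w ⊎ ΓEdge p q r w v }

-- Heaps are isomorphism classes of labelled heaps; all properties below
-- are isomorphism invariant, so we quantify over labelled heaps.

record LHeap (P : Set) (C : P → P → Set) : Set₁ where
  field
    n       : ℕ
    _≤_     : Fin n → Fin n → Set
    ε       : Fin n → P
    ≤-refl  : ∀ a → a ≤ a
    ≤-antisym : ∀ {a b} → a ≤ b → b ≤ a → a ≡ b
    ≤-trans : ∀ {a b c} → a ≤ b → b ≤ c → a ≤ c
    comparable : ∀ a b → C (ε a) (ε b) → (a ≤ b) ⊎ (b ≤ a)
    closure : ∀ a b → (a ≤ b) ⇔ TransClosure (λ x y → (x ≤ y) × C (ε x) (ε y)) a b

module _ {P : Set} {C : P → P → Set} (E : LHeap P C) where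
  open LHeap E

  _<_ : Fin n → Fin n → Set
  a < b = (a ≤ b) × (a ≢ b)

  -- Convex chains x₀ < x₁ < ... < x_{m} of length t = suc m
  IsConvexChain : {m : ℕ} → (Fin (suc m) → Fin n) → Set
  IsConvexChain {m} x =
      (∀ (i : Fin m) → x (inject₁ i) < x (fsuc i))
    × (∀ (i j : Fin (suc m)) (y : Fin n) → x i < y → y < x j →
         ∃ λ k → y ≡ x k)

  IsBalanced : {m : ℕ} → (Fin (suc m) → Fin n) → Set
  IsBalanced {m} x = ε (x fzero) ≡ ε (x (fromℕ m))

  PropertyP2 : Set
  PropertyP2 =
      (∀ (x : Fin 2 → Fin n) → ¬ (IsConvexChain x × IsBalanced x))
    × (∀ (x : Fin 3 → Fin n) → ¬ (IsConvexChain x × IsBalanced x))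

  -- Subheaps on a subset S of the carrier (with the induced order & labels)
  IsMaximalIn : Subset n → Fin n → Set
  IsMaximalIn S a = a ∈ S × (∀ b → b ∈ S → a ≤ b → b ≡ a)

  IsMinimalIn : Subset n → Fin n → Set
  IsMinimalIn S a = a ∈ S × (∀ b → b ∈ S → b ≤ a → b ≡ a)

  IsTrivial : Subset n → Set
  IsTrivial S = ∀ a b → a ∈ S → b ∈ S → a ≤ b → a ≡ b

  -- (S - a) ≺⁺ S
  Prec⁺ : Subset n → Fin n → Set
  Prec⁺ S a = IsMaximalIn S a
    × ∃ λ b → IsMaximalIn (S - a) b × ¬ IsMaximalIn S b × ε b ≢ ε a

  -- (S - a) ≺⁻ S
  Prec⁻ : Subset n → Fin n → Set
  Prec⁻ S a = IsMinimalIn S a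
    × ∃ λ b → IsMinimalIn (S - a) b × ¬ IsMinimalIn S b × ε b ≢ ε a

  -- There is a (possibly trivial) sequence E₁ ≺ ⋯ ≺ S with E₁ trivial
  data P1On : Subset n → Set where
    trivial : ∀ {S} → IsTrivial S → P1On S
    step    : ∀ {S} a → (Prec⁺ S a ⊎ Prec⁻ S a) → P1On (S - a) → P1On S

  PropertyP1 : Set
  PropertyP1 = P1On ⊤

ConcurrencyGraphIso : (P : Set) (C : P → P → Set) (G : Graph) → Set
ConcurrencyGraphIso P C G =
  Σ (Bijection (setoid P)
               (setoid (Graph.V G))) λ f →
    ∀ v w → ((v ≢ w) × C v w) ⇔ Graph.Adj G (Bijection.to f v) (Bijection.to f w)

PropertyR : Graph → Set₁
PropertyR G = Σ Set λ P → Σ (P → P → Set) λ C →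
    (∀ v w → C v w → C w v)
  × (∀ v → C v v)
  × ConcurrencyGraphIso P C G
  × (∀ (E : LHeap P C) → PropertyP2 E → PropertyP1 E)

-- For r ≥ 3 the 20-letter word  a₁ d₁ c b₁ b₂ d₃ d₂ d₁ c a₁ a₂ b₁ c a₁ d₁ c b₁ d₂ d₁ d₃
-- over the vertices of Γ(2,2,r) (c the centre, aᵢ, bᵢ, dᵢ the i-th vertices of the three
-- arms), with "equal or adjacent" as concurrency, spells a heap in which every balanced
-- interval contains two further elements, so it has P2; yet no maximal or minimal element
-- can be removed as P1 demands, and the heap is not trivial, so it lacks P1.  A realisation
-- of Γ(2,2,r) as a concurrency graph turns this heap into a counterexample by relabelling
-- along the bijection.  The two properties of the heap are decided by evaluation.

module Submission where

open import Defs
open import Data.Nat using (ℕ; _≤_)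
open import Relation.Binary.PropositionalEquality using (_≡_)

open import Data.Nat using (zero; suc; z≤n; s≤s; _+_)
import Data.Nat as ℕ
open import Data.Bool using (Bool; true; false; T)
open import Data.Empty using (⊥-elim)
open import Data.Fin as Fin using (Fin; zero; suc)
open import Data.Fin.Properties using (_≟_; all?; any?)
import Data.Fin.Properties as Finₚ
open import Data.Fin.Subset using (⊤; _-_)
open import Data.Fin.Subset.Properties using (∈⊤; _∈?_)
open import Data.Product using (∃; _×_; _,_; proj₁; proj₂; map₂)
open import Data.Sum as Sum using (_⊎_; inj₁; inj₂)
open import Data.Unit using (tt)
open import Data.Vec using (Vec; []; _∷_; lookup; tabulate; map)
open import Data.Vec.Properties using (lookup∘tabulate; lookup-map)
open import Function using (id; _∘_)
open import Function.Bundles using (_⇔_; mk⇔; Equivalence; Bijection; Surjection)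
open import Function.Definitions using (Injective)
open import Relation.Binary.Core using (_=[_]⇒_)
open import Relation.Binary.Definitions using (Decidable; DecidableEquality)
open import Relation.Binary.Construct.Closure.Transitive using (TransClosure; [_]; _∷_; _++_; transitive⁻)
open import Relation.Binary.PropositionalEquality using (refl; sym; trans; cong; subst; subst₂; _≢_)
open import Relation.Nullary using (¬_; Dec; yes; no; ¬?; _×-dec_; _⊎-dec_; _→-dec_; map′)
open import Relation.Nullary.Decidable using (⌊_⌋; T?; toWitness; fromWitness)

module _ {A B : Set} {R : A → A → Set} {S : B → B → Set} where

  gmap⁺ : (f : A → B) → R =[ f ]⇒ S → TransClosure R =[ f ]⇒ TransClosure S
  gmap⁺ f R⇒S [ xRy ]        = [ R⇒S xRy ]
  gmap⁺ f R⇒S (xRy ∷ yR⁺z) = R⇒S xRy ∷ gmap⁺ f R⇒S yR⁺z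

module _ {P Q : Set} {C : P → P → Set} {D : Q → Q → Set}
         (h : Q → P) (C⇔D : ∀ u v → C (h u) (h v) ⇔ D u v) (E : LHeap Q D) where
  open LHeap E renaming (_≤_ to _≼_)

  relabel : LHeap P C
  relabel = record
    { n          = n
    ; _≤_        = _≼_
    ; ε          = h ∘ ε
    ; ≤-refl     = ≤-refl
    ; ≤-antisym  = ≤-antisym
    ; ≤-trans    = ≤-trans
    ; comparable = λ a b → comparable a b ∘ Equivalence.to (C⇔D (ε a) (ε b))
    ; closure    = λ a b → mk⇔ (gmap⁺ id (λ { (x≤y , c) → x≤y , Equivalence.from (C⇔D _ _) c })
                                 ∘ Equivalence.to (closure a b))
                               (Equivalence.from (closure a b)
                                 ∘ gmap⁺ id (λ { (x≤y , c) → x≤y , Equivalence.to (C⇔D _ _) c }))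
    }

  relabel-P2 : Injective _≡_ _≡_ h → PropertyP2 E → PropertyP2 relabel
  relabel-P2 h-injective (noChain₂ , noChain₃) =
    (λ x (convex , balanced) → noChain₂ x (convex , h-injective balanced)) ,
    (λ x (convex , balanced) → noChain₃ x (convex , h-injective balanced))

  relabel-P1On : ∀ {S} → P1On relabel S → P1On E S
  relabel-P1On (trivial t) = trivial t
  relabel-P1On (step a (inj₁ (a-max , b , b-max , ¬b-max , εb≢εa)) p1) =
    step a (inj₁ (a-max , b , b-max , ¬b-max , εb≢εa ∘ cong h)) (relabel-P1On p1)
  relabel-P1On (step a (inj₂ (a-min , b , b-min , ¬b-min , εb≢εa)) p1) =
    step a (inj₂ (a-min , b , b-min , ¬b-min , εb≢εa ∘ cong h)) (relabel-P1On p1)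

Concurrent : (G : Graph) → Graph.V G → Graph.V G → Set
Concurrent G v w = v ≡ w ⊎ Graph.Adj G v w

propertyR⇒P2⇒P1 : ∀ {G} → DecidableEquality (Graph.V G) → PropertyR G →
                  (E : LHeap (Graph.V G) (Concurrent G)) → PropertyP2 E → PropertyP1 E
propertyR⇒P2⇒P1 {G} _≟ᵥ_ (_ , C , _ , C-refl , (f , f-adj) , p2⇒p1) E =
  relabel-P1On {C = C} from C⇔Concurrent E ∘ p2⇒p1 _
    ∘ relabel-P2 {C = C} from C⇔Concurrent E from-injective
  where
  open Bijection f using (to)
  open Surjection (Bijection.surjection f) using (to∘to⁻) renaming (to⁻ to from)

  from-injective : Injective _≡_ _≡_ from
  from-injective {u} {v} eq = trans (sym (to∘to⁻ u)) (trans (cong to eq) (to∘to⁻ v))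

  C⇔Concurrent : ∀ u v → C (from u) (from v) ⇔ Concurrent G u v
  C⇔Concurrent u v = mk⇔ forward backward
    where
    forward : C (from u) (from v) → Concurrent G u v
    forward c with u ≟ᵥ v
    ... | yes u≡v = inj₁ u≡v
    ... | no  u≢v = inj₂ (subst₂ (Graph.Adj G) (to∘to⁻ u) (to∘to⁻ v)
                            (Equivalence.to (f-adj _ _) (u≢v ∘ from-injective , c)))
    backward : Concurrent G u v → C (from u) (from v)
    backward (inj₁ refl) = C-refl (from u)
    backward (inj₂ adj)  = proj₂ (Equivalence.from (f-adj _ _)
                             (subst₂ (Graph.Adj G) (sym (to∘to⁻ u)) (sym (to∘to⁻ v)) adj))

module WordHeap {V : Set} (_~_ : V → V → Set)
                (~-refl : ∀ v → v ~ v) (~-sym : ∀ {v w} → v ~ w → w ~ v) where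

  Step : ∀ {n} → (Fin n → V) → Fin n → Fin n → Set
  Step w i j = i Fin.≤ j × w i ~ w j

  Precedes : ∀ {n} → (Fin n → V) → Fin n → Fin n → Set
  Precedes w = TransClosure (Step w)

  module _ {n} {w : Fin n → V} where

    precedes-refl : ∀ i → Precedes w i i
    precedes-refl i = [ Finₚ.≤-refl , ~-refl (w i) ]

    precedes⇒≤ : ∀ {i j} → Precedes w i j → i Fin.≤ j
    precedes⇒≤ = transitive⁻ _ Finₚ.≤-trans ∘ gmap⁺ id proj₁

  heapOfWord : ∀ {n} → (Fin n → V) → LHeap V _~_
  heapOfWord {n} w = record
    { n          = n
    ; _≤_        = Precedes w
    ; ε          = w
    ; ≤-refl     = precedes-refl
    ; ≤-antisym  = λ p q → Finₚ.≤-antisym (precedes⇒≤ p) (precedes⇒≤ q)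
    ; ≤-trans    = _++_
    ; comparable = λ a b a~b →
                     Sum.map (λ a≤b → [ a≤b , a~b ]) (λ b≤a → [ b≤a , ~-sym a~b ]) (Finₚ.≤-total a b)
    ; closure    = λ a b → mk⇔ (gmap⁺ id λ s → [ s ] , proj₂ s) (transitive⁻ _ _++_ ∘ gmap⁺ id proj₁)
    }

  module _ {n} {w : Fin (suc n) → V} where

    precedes-suc⁺ : ∀ {i j} → Precedes (w ∘ suc) i j → Precedes w (suc i) (suc j)
    precedes-suc⁺ = gmap⁺ suc λ { (i≤j , c) → s≤s i≤j , c }

    precedes-suc⁻ : ∀ {i j} → Precedes w (suc i) (suc j) → Precedes (w ∘ suc) i j
    precedes-suc⁻ [ s≤s i≤j , c ]                       = [ i≤j , c ]
    precedes-suc⁻ (_∷_ {y = suc _} (s≤s i≤m , c) m≼j) = (i≤m , c) ∷ precedes-suc⁻ m≼j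

    precedes-zero-suc : ∀ {j} → Precedes w zero (suc j) ⇔ ∃ λ k → w zero ~ w (suc k) × Precedes (w ∘ suc) k j
    precedes-zero-suc = mk⇔ firstStep (λ { (k , c , k≼j) → (z≤n , c) ∷ precedes-suc⁺ k≼j })
      where
      firstStep : ∀ {j} → Precedes w zero (suc j) → ∃ λ k → w zero ~ w (suc k) × Precedes (w ∘ suc) k j
      firstStep {j} [ _ , c ]                    = j , c , precedes-refl j
      firstStep (_∷_ {y = zero}  _       0≼j) = firstStep 0≼j
      firstStep (_∷_ {y = suc k} (_ , c) k≼j) = k , c , precedes-suc⁻ k≼j

    suc⋠zero : ∀ {i} → ¬ Precedes w (suc i) zero
    suc⋠zero i≼0 with precedes⇒≤ i≼0
    ... | ()

  module Reachability (_~?_ : Decidable _~_) where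

    Matrix : ℕ → Set
    Matrix n = Vec (Vec Bool n) n

    Entry : ∀ {n} → Matrix n → Fin n → Fin n → Set
    Entry M i j = T (lookup (lookup M i) j)

    StepsInto : ∀ {n} → V → (Fin n → V) → Matrix n → Fin n → Set
    StepsInto x w M j = ∃ λ k → x ~ w k × Entry M k j

    stepsInto? : ∀ {n} x (w : Fin n → V) M j → Dec (StepsInto x w M j)
    stepsInto? x w M j = any? λ k → x ~? w k ×-dec T? (lookup (lookup M k) j)

    prepend : ∀ {n} → V → (Fin n → V) → Matrix n → Matrix (suc n)
    prepend x w M = (true ∷ tabulate λ j → ⌊ stepsInto? x w M j ⌋) ∷ map (false ∷_) M

    reachability : ∀ {n} → (Fin n → V) → Matrix n
    reachability {zero}  w = []
    reachability {suc n} w = prepend (w zero) (w ∘ suc) (reachability (w ∘ suc))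

    module _ {n} {w : Fin (suc n) → V} {M : Matrix n}
             (M-correct : ∀ i j → Entry M i j ⇔ Precedes (w ∘ suc) i j) where

      prepend-correct : ∀ i j → Entry (prepend (w zero) (w ∘ suc) M) i j ⇔ Precedes w i j
      prepend-correct zero zero = mk⇔ (λ _ → precedes-refl zero) (λ _ → tt)
      prepend-correct zero (suc j) =
        subst (_⇔ Precedes w zero (suc j))
              (cong T (sym (lookup∘tabulate (λ j → ⌊ stepsInto? (w zero) (w ∘ suc) M j ⌋) j)))
              (mk⇔ (Equivalence.from precedes-zero-suc ∘ map₂ (map₂ (Equivalence.to (M-correct _ j)))
                      ∘ toWitness {a? = stepsInto? (w zero) (w ∘ suc) M j})
                   (fromWitness ∘ map₂ (map₂ (Equivalence.from (M-correct _ j)))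
                      ∘ Equivalence.to precedes-zero-suc))
      prepend-correct (suc i) j =
        subst (_⇔ Precedes w (suc i) j)
              (cong (λ row → T (lookup row j)) (sym (lookup-map i (false ∷_) M)))
              (shifted j)
        where
        shifted : ∀ j → T (lookup (false ∷ lookup M i) j) ⇔ Precedes w (suc i) j
        shifted zero    = mk⇔ (λ ()) suc⋠zero
        shifted (suc j) = mk⇔ (precedes-suc⁺ ∘ Equivalence.to (M-correct i j))
                              (Equivalence.from (M-correct i j) ∘ precedes-suc⁻)

    reachability-correct : ∀ {n} (w : Fin n → V) i j → Entry (reachability w) i j ⇔ Precedes w i j
    reachability-correct {suc n} w = prepend-correct (reachability-correct (w ∘ suc))

    precedes? : ∀ {n} (w : Fin n → V) → Decidable (Precedes w)
    precedes? w = decide (reachability w) (reachability-correct w)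
      where
      -- Taking the table as an argument makes the type checker evaluate it once, not per query.
      decide : (M : Matrix _) → (∀ i j → Entry M i j ⇔ Precedes w i j) → Decidable (Precedes w)
      decide M M-correct i j =
        map′ (Equivalence.to (M-correct i j)) (Equivalence.from (M-correct i j)) (T? _)

module HeapProperties {P : Set} {C : P → P → Set} (E : LHeap P C) where
  open LHeap E renaming (_≤_ to _≼_)

  infix 4 _⊏_
  _⊏_ : Fin n → Fin n → Set
  _⊏_ = _<_ E

  ⊏-trans : ∀ {a b c} → a ⊏ b → b ⊏ c → a ⊏ c
  ⊏-trans (a≤b , a≢b) (b≤c , _) = ≤-trans a≤b b≤c , λ { refl → a≢b (≤-antisym a≤b b≤c) }

  StrictlyBetween : Fin n → Fin n → Fin n → Set
  StrictlyBetween a c y = a ⊏ y × y ⊏ c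

  TwoInteriorPoints : Set
  TwoInteriorPoints = ∀ a c → a ⊏ c → ε a ≡ ε c →
    ∃ λ y → StrictlyBetween a c y × ∃ λ z → y ≢ z × StrictlyBetween a c z

  twoInteriorPoints⇒P2 : TwoInteriorPoints → PropertyP2 E
  twoInteriorPoints⇒P2 interior = noChain₂ , noChain₃
    where
    noChain₂ : ∀ (x : Fin 2 → Fin n) → ¬ (IsConvexChain E x × IsBalanced E x)
    noChain₂ x ((links , convex) , balanced)
      with y , (x₀⊏y , y⊏x₁) , _ ← interior _ _ (links zero) balanced
      with convex zero (suc zero) y x₀⊏y y⊏x₁
    ... | zero     , y≡x₀ = proj₂ x₀⊏y (sym y≡x₀)
    ... | suc zero , y≡x₁ = proj₂ y⊏x₁ y≡x₁

    noChain₃ : ∀ (x : Fin 3 → Fin n) → ¬ (IsConvexChain E x × IsBalanced E x)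
    noChain₃ x ((links , convex) , balanced) =
      let y , y-between , z , y≢z , z-between =
            interior _ _ (⊏-trans (links zero) (links (suc zero))) balanced
      in  y≢z (trans (middle y y-between) (sym (middle z z-between)))
      where
      middle : ∀ y → StrictlyBetween (x zero) (x (suc (suc zero))) y → y ≡ x (suc zero)
      middle y (x₀⊏y , y⊏x₂) with convex zero (suc (suc zero)) y x₀⊏y y⊏x₂
      ... | zero           , y≡x₀ = ⊥-elim (proj₂ x₀⊏y (sym y≡x₀))
      ... | suc zero       , y≡x₁ = y≡x₁
      ... | suc (suc zero) , y≡x₂ = ⊥-elim (proj₂ y⊏x₂ y≡x₂)

  Reducible : Fin n → Set
  Reducible a = Prec⁺ E ⊤ a ⊎ Prec⁻ E ⊤ a

  nonTrivial-irreducible⇒¬P1 : ∀ {a b} → a ⊏ b → (∀ c → ¬ Reducible c) → ¬ PropertyP1 E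
  nonTrivial-irreducible⇒¬P1 (a≤b , a≢b) _           (trivial t)      = a≢b (t _ _ ∈⊤ ∈⊤ a≤b)
  nonTrivial-irreducible⇒¬P1 _          irreducible (step c reduce _) = irreducible c reduce

  module Decisions (_≼?_ : Decidable _≼_) (_≟ₚ_ : DecidableEquality P) where

    _⊏?_ : Decidable _⊏_
    a ⊏? b = a ≼? b ×-dec ¬? (a ≟ b)

    twoInteriorPoints? : Dec TwoInteriorPoints
    twoInteriorPoints? =
      all? λ a → all? λ c → a ⊏? c →-dec ε a ≟ₚ ε c →-dec
        any? λ y → between? a c y ×-dec any? λ z → ¬? (y ≟ z) ×-dec between? a c z
      where
      between? : ∀ a c y → Dec (StrictlyBetween a c y)
      between? a c y = a ⊏? y ×-dec y ⊏? c

    isMaximalIn? : ∀ S a → Dec (IsMaximalIn E S a)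
    isMaximalIn? S a = a ∈? S ×-dec all? λ b → b ∈? S →-dec a ≼? b →-dec b ≟ a

    isMinimalIn? : ∀ S a → Dec (IsMinimalIn E S a)
    isMinimalIn? S a = a ∈? S ×-dec all? λ b → b ∈? S →-dec b ≼? a →-dec b ≟ a

    reducible? : ∀ a → Dec (Reducible a)
    reducible? a = prec⁺? ⊎-dec prec⁻?
      where
      prec⁺? = isMaximalIn? ⊤ a ×-dec any? λ b →
        isMaximalIn? (⊤ - a) b ×-dec ¬? (isMaximalIn? ⊤ b) ×-dec ¬? (ε b ≟ₚ ε a)
      prec⁻? = isMinimalIn? ⊤ a ×-dec any? λ b →
        isMinimalIn? (⊤ - a) b ×-dec ¬? (isMinimalIn? ⊤ b) ×-dec ¬? (ε b ≟ₚ ε a)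

module _ {p q r : ℕ} where

  _≟Γ_ : DecidableEquality (ΓV p q r)
  centre ≟Γ centre = yes refl
  armP i ≟Γ armP j = map′ (cong armP) (λ { refl → refl }) (i ≟ j)
  armQ i ≟Γ armQ j = map′ (cong armQ) (λ { refl → refl }) (i ≟ j)
  armR i ≟Γ armR j = map′ (cong armR) (λ { refl → refl }) (i ≟ j)
  centre ≟Γ armP _ = no λ ()
  centre ≟Γ armQ _ = no λ ()
  centre ≟Γ armR _ = no λ ()
  armP _ ≟Γ centre = no λ ()
  armP _ ≟Γ armQ _ = no λ ()
  armP _ ≟Γ armR _ = no λ ()
  armQ _ ≟Γ centre = no λ ()
  armQ _ ≟Γ armP _ = no λ ()
  armQ _ ≟Γ armR _ = no λ ()
  armR _ ≟Γ centre = no λ ()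
  armR _ ≟Γ armP _ = no λ ()
  armR _ ≟Γ armQ _ = no λ ()

  ΓEdge? : Decidable (ΓEdge p q r)
  ΓEdge? centre   (armP i) = map′ (cP i) (λ { (cP _ e) → e }) (Fin.toℕ i ℕ.≟ 0)
  ΓEdge? centre   (armQ i) = map′ (cQ i) (λ { (cQ _ e) → e }) (Fin.toℕ i ℕ.≟ 0)
  ΓEdge? centre   (armR i) = map′ (cR i) (λ { (cR _ e) → e }) (Fin.toℕ i ℕ.≟ 0)
  ΓEdge? (armP i) (armP j) = map′ (pP i j) (λ { (pP _ _ e) → e }) (suc (Fin.toℕ i) ℕ.≟ Fin.toℕ j)
  ΓEdge? (armQ i) (armQ j) = map′ (pQ i j) (λ { (pQ _ _ e) → e }) (suc (Fin.toℕ i) ℕ.≟ Fin.toℕ j)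
  ΓEdge? (armR i) (armR j) = map′ (pR i j) (λ { (pR _ _ e) → e }) (suc (Fin.toℕ i) ℕ.≟ Fin.toℕ j)
  ΓEdge? centre   centre   = no λ ()
  ΓEdge? (armP _) centre   = no λ ()
  ΓEdge? (armP _) (armQ _) = no λ ()
  ΓEdge? (armP _) (armR _) = no λ ()
  ΓEdge? (armQ _) centre   = no λ ()
  ΓEdge? (armQ _) (armP _) = no λ ()
  ΓEdge? (armQ _) (armR _) = no λ ()
  ΓEdge? (armR _) centre   = no λ ()
  ΓEdge? (armR _) (armP _) = no λ ()
  ΓEdge? (armR _) (armQ _) = no λ ()

  concurrent? : Decidable (Concurrent (Γ p q r))
  concurrent? v w = v ≟Γ w ⊎-dec ΓEdge? v w ⊎-dec ΓEdge? w v

  concurrent-sym : ∀ {v w} → Concurrent (Γ p q r) v w → Concurrent (Γ p q r) w v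
  concurrent-sym = Sum.map sym Sum.swap

module Counterexample (k : ℕ) where
  open WordHeap (Concurrent (Γ 2 2 (3 + k))) (λ _ → inj₁ refl) concurrent-sym
  open Reachability concurrent?

  c a₁ a₂ b₁ b₂ d₁ d₂ d₃ : ΓV 2 2 (3 + k)
  c  = centre
  a₁ = armP zero
  a₂ = armP (suc zero)
  b₁ = armQ zero
  b₂ = armQ (suc zero)
  d₁ = armR zero
  d₂ = armR (suc zero)
  d₃ = armR (suc (suc zero))

  word : Vec (ΓV 2 2 (3 + k)) 20
  word = a₁ ∷ d₁ ∷ c ∷ b₁ ∷ b₂ ∷ d₃ ∷ d₂ ∷ d₁ ∷ c ∷ a₁ ∷ a₂ ∷ b₁ ∷ c ∷ a₁ ∷ d₁ ∷ c ∷ b₁ ∷ d₂ ∷ d₁ ∷ d₃ ∷ []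

  heap : LHeap (ΓV 2 2 (3 + k)) (Concurrent (Γ 2 2 (3 + k)))
  heap = heapOfWord (lookup word)

  open HeapProperties heap
  open Decisions (precedes? (lookup word)) _≟Γ_

  heap-P2 : PropertyP2 heap
  heap-P2 = twoInteriorPoints⇒P2 (toWitness {a? = twoInteriorPoints?} tt)

  heap-¬P1 : ¬ PropertyP1 heap
  heap-¬P1 = nonTrivial-irreducible⇒¬P1 {zero} {suc (suc zero)} (toWitness {a? = _ ⊏? _} tt)
               (toWitness {a? = all? (¬? ∘ reducible?)} tt)

lemma3p4p5 : (r : ℕ) → 2 ≤ r → PropertyR (Γ 2 2 r) → r ≡ 2
lemma3p4p5 (suc zero)          (s≤s ()) _
lemma3p4p5 (suc (suc zero))    _        _ = refl
lemma3p4p5 (suc (suc (suc k))) _        R =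
  ⊥-elim (heap-¬P1 (propertyR⇒P2⇒P1 _≟Γ_ R heap heap-P2))
  where open Counterexample k
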